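{- For every $S\in\{S_1,\ldots,S_{15}\}$ and every positive integer $h$, $M_1=1+x+x^2$ does not divide $\sigma(S^{2h})=1+S+\cdots+S^{2h}$.
   Context: All polynomials are in $\mathbb{F}_2[x]$; $\sigma(A)$ is the sum of all divisors of $A$. For $Q$ and positive integers $a,b,c$, $Q^{abc}:=1+x^a(x+1)^bQ^c$. $S_1=M_1^{111}$, $S_2=M_1^{221}$, $S_3=M_1^{134}$, $S_4=M_1^{311}$, $S_5=M_1^{131}$, $S_6=M_1^{314}$, $S_7=M_1^{113}$, $S_8=M_1^{331}$, $S_9=M_1^{115}$, $S_{10}=M_1^{411}$, $S_{11}=M_1^{121}$, $S_{12}=M_1^{212}$, $S_{13}=M_1^{141}$, $S_{14}=M_1^{211}$, $S_{15}=M_1^{122}$, with $M_1=1+x+x^2$. -}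

module Defs where

open import Data.Bool using (Bool; true; false; _xor_; _∧_; not; if_then_else_)
open import Data.List using (List; []; _∷_; length; foldr; map; _++_; filter)
open import Data.Nat using (ℕ; zero; suc; _∸_)
open import Data.Product using (∃; _,_)
open import Relation.Binary.PropositionalEquality using (_≡_)
open import Relation.Nullary using (¬_)

-- Polynomials in 𝔽₂[x]: coefficient lists, lowest degree first
-- (index i = coefficient of x^i). Lists differing by trailing
-- zero coefficients represent the same polynomial; `norm` strips them.
Poly : Set
Poly = List Bool

norm : Poly → Poly
norm [] = []
norm (b ∷ p) with norm p
... | [] = if b then true ∷ [] else []
... | q@(_ ∷ _) = b ∷ q

_≈ₚ_ : Poly → Poly → Set
p ≈ₚ q = norm p ≡ norm q

infixl 6 _+ₚ_
infixl 7 _*ₚ_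

_+ₚ_ : Poly → Poly → Poly
[] +ₚ q = q
(a ∷ p) +ₚ [] = a ∷ p
(a ∷ p) +ₚ (b ∷ q) = (a xor b) ∷ (p +ₚ q)

scale : Bool → Poly → Poly
scale b = map (λ c → b ∧ c)

_*ₚ_ : Poly → Poly → Poly
[] *ₚ q = []
(a ∷ p) *ₚ q = scale a q +ₚ (false ∷ (p *ₚ q))

0ₚ 1ₚ X : Poly
0ₚ = []
1ₚ = true ∷ []
X = false ∷ true ∷ []

_^ₚ_ : Poly → ℕ → Poly
p ^ₚ zero = 1ₚ
p ^ₚ suc n = p *ₚ (p ^ₚ n)

_∣ₚ_ : Poly → Poly → Set
a ∣ₚ b = ∃ λ c → (a *ₚ c) ≈ₚ b

_∤ₚ_ : Poly → Poly → Set
a ∤ₚ b = ¬ (a ∣ₚ b)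

-- Sum of divisors σ(A): sum of all (monic = nonzero, over 𝔽₂)
-- divisors of A. For A ≠ 0 every divisor has degree ≤ deg A, so we
-- enumerate all polynomials with at most `length (norm A)` coefficients
-- and keep the nonzero ones dividing A (decided by remainder = 0).

allLists : ℕ → List Poly
allLists zero = [] ∷ []
allLists (suc n) = map (false ∷_) (allLists n) ++ map (true ∷_) (allLists n)

isZero : Poly → Bool
isZero p with norm p
... | [] = true
... | _ ∷ _ = false

lastCoeffIsOne : Poly → Bool
lastCoeffIsOne p = not (isZero p)

shift : ℕ → Poly → Poly
shift zero p = p
shift (suc k) p = false ∷ shift k p

modₚ-fuel : ℕ → Poly → Poly → Poly
modₚ-fuel zero a b = norm a
modₚ-fuel (suc f) a b with norm a | norm b
... | a' | b' with length a' Data.Nat.<ᵇ length b'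
...   | true = a'
...   | false = modₚ-fuel f (a' +ₚ shift (length a' ∸ length b') b') b
  where import Data.Nat

_modₚ_ : Poly → Poly → Poly
a modₚ b = modₚ-fuel (length a) a b

divides? : Poly → Poly → Bool
divides? d a = if isZero d then isZero a else isZero (a modₚ d)

divisors : Poly → List Poly
divisors A =
  filter (λ d → Data.Bool._≟_ (not (isZero d) ∧ divides? d A) true)
         (map norm (allLists (length (norm A))))
  where import Data.Bool

sum : List Poly → Poly
sum = foldr _+ₚ_ 0ₚ

σ : Poly → Poly
σ A = sum (divisors A)

M₁ : Poly
M₁ = true ∷ true ∷ true ∷ []

Qabc : Poly → ℕ → ℕ → ℕ → Poly
Qabc Q a b c = 1ₚ +ₚ ((X ^ₚ a) *ₚ ((X +ₚ 1ₚ) ^ₚ b) *ₚ (Q ^ₚ c))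

data Idx : Set where
  i1 i2 i3 i4 i5 i6 i7 i8 i9 i10 i11 i12 i13 i14 i15 : Idx

S : Idx → Poly
S i1  = Qabc M₁ 1 1 1
S i2  = Qabc M₁ 2 2 1
S i3  = Qabc M₁ 1 3 4
S i4  = Qabc M₁ 3 1 1
S i5  = Qabc M₁ 1 3 1
S i6  = Qabc M₁ 3 1 4
S i7  = Qabc M₁ 1 1 3
S i8  = Qabc M₁ 3 3 1
S i9  = Qabc M₁ 1 1 5
S i10 = Qabc M₁ 4 1 1
S i11 = Qabc M₁ 1 2 1
S i12 = Qabc M₁ 2 1 2
S i13 = Qabc M₁ 1 4 1
S i14 = Qabc M₁ 2 1 1
S i15 = Qabc M₁ 1 2 2

module Submission where

-- Let ω ∈ 𝔽₄ be a root of M₁, so every multiple of M₁ vanishes at ω.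
-- Each S is irreducible and takes the value 1 at ω.  For an irreducible P
-- the divisors of Pⁿ are 1, P, …, Pⁿ, hence σ(Pⁿ) takes the value (n + 1)·1
-- at ω, which is 1 ≠ 0 when n is even.

open import Defs
open import Algebra.Properties.CommutativeSemigroup using (interchange)
open import Data.Bool using (Bool; true; false; _xor_; _∧_; not; T)
import Data.Bool as Bool
open import Data.Bool.Properties
  using (xor-assoc; xor-comm; xor-same; xor-identityʳ; ∧-zeroʳ; ∧-comm; ∧-assoc; T-≡; ¬-not)
open import Data.Empty using (⊥-elim)
open import Data.List using (List; []; _∷_; _++_; length; map; filter; drop)
open import Data.List.Properties using (length-map)
open import Data.List.Relation.Unary.All using (All; []; _∷_)
import Data.List.Relation.Unary.All as All
open import Data.List.Relation.Unary.All.Properties using (all-filter)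
open import Data.Nat using (ℕ; zero; suc; _+_; _*_; _∸_; _≤_; _<_; z≤n; s≤s; _≤?_; _≤ᵇ_; _<ᵇ_; _≡ᵇ_)
open import Data.Nat.Properties
  using (≤-refl; ≤-trans; ≤-<-trans; ≤-pred; <-trans; ≤-antisym; ≰⇒>; <⇒≱; <⇒≤; ≮⇒≥; ≤∧≢⇒<;
         n≤0⇒n≡0; m≤n⇒m≤1+n; m+[n∸m]≡n; suc-injective; <-irrefl;
         +-comm; +-assoc; +-suc; +-identityʳ; +-monoˡ-≤; +-monoʳ-≤; +-mono-≤; +-cancelˡ-≤;
         *-cancelʳ-≡; *-monoˡ-≤; <ᵇ⇒<; <⇒<ᵇ; ≤⇒≤ᵇ; ≤ᵇ⇒≤; ≡ᵇ⇒≡;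
         +-commutativeSemigroup; module ≤-Reasoning)
open import Data.Product using (Σ; _×_; _,_; proj₁; proj₂)
open import Data.Sum using (_⊎_; inj₁; inj₂)
open import Data.Unit using (tt)
open import Function.Base using (case_of_)
open import Function.Bundles using (Equivalence)
open import Level using (0ℓ)
open import Relation.Binary.Bundles using (Setoid)
open import Relation.Binary.PropositionalEquality
  using (_≡_; _≢_; refl; sym; trans; cong; cong₂; subst; subst₂; module ≡-Reasoning)
import Relation.Binary.Reasoning.Setoid as SetoidReasoning
open import Relation.Nullary using (¬_; Dec; yes; no)

coef : Poly → ℕ → Bool
coef []      i       = false
coef (b ∷ p) zero    = b
coef (b ∷ p) (suc i) = coef p i

-- Coefficientwise equality: the polynomial identity underlying _≈ₚ_,
-- convenient because every ring law is checked one coefficient at a time.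
infix 4 _~_
record _~_ (p q : Poly) : Set where
  constructor coeffwise
  field at : ∀ i → coef p i ≡ coef q i
open _~_ public

~-refl : ∀ {p} → p ~ p
~-refl = coeffwise λ i → refl

~-sym : ∀ {p q} → p ~ q → q ~ p
~-sym e = coeffwise λ i → sym (at e i)

~-trans : ∀ {p q r} → p ~ q → q ~ r → p ~ r
~-trans e f = coeffwise λ i → trans (at e i) (at f i)

~-setoid : Setoid 0ℓ 0ℓ
~-setoid = record
  { Carrier = Poly ; _≈_ = _~_
  ; isEquivalence = record { refl = ~-refl ; sym = ~-sym ; trans = ~-trans } }

module ~-Reasoning = SetoidReasoning ~-setoid

Zero : Poly → Set
Zero p = p ~ []

∷-cong : ∀ {a b p q} → a ≡ b → p ~ q → (a ∷ p) ~ (b ∷ q)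
∷-cong e f = coeffwise λ { zero → e ; (suc i) → at f i }

∷-head : ∀ {a b p q} → (a ∷ p) ~ (b ∷ q) → a ≡ b
∷-head e = at e zero

∷-tail : ∀ {a b p q} → (a ∷ p) ~ (b ∷ q) → p ~ q
∷-tail e = coeffwise λ i → at e (suc i)

zero-∷ : ∀ {p} → Zero p → Zero (false ∷ p)
zero-∷ z = coeffwise λ { zero → refl ; (suc i) → at z i }

zero-head : ∀ {b p} → Zero (b ∷ p) → b ≡ false
zero-head z = at z zero

zero-tail : ∀ {b p} → Zero (b ∷ p) → Zero p
zero-tail z = coeffwise λ i → at z (suc i)

coef-+ : ∀ p q i → coef (p +ₚ q) i ≡ coef p i xor coef q i
coef-+ []      q       i       = refl
coef-+ (a ∷ p) []      i       = sym (xor-identityʳ _)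
coef-+ (a ∷ p) (b ∷ q) zero    = refl
coef-+ (a ∷ p) (b ∷ q) (suc i) = coef-+ p q i

coef-scale : ∀ a q i → coef (scale a q) i ≡ a ∧ coef q i
coef-scale a []      i       = sym (∧-zeroʳ a)
coef-scale a (b ∷ q) zero    = refl
coef-scale a (b ∷ q) (suc i) = coef-scale a q i

+ₚ-cong : ∀ {p p' q q'} → p ~ p' → q ~ q' → p +ₚ q ~ p' +ₚ q'
+ₚ-cong {p} {p'} {q} {q'} e f = coeffwise λ i → begin
  coef (p +ₚ q) i          ≡⟨ coef-+ p q i ⟩
  coef p i xor coef q i    ≡⟨ cong₂ _xor_ (at e i) (at f i) ⟩
  coef p' i xor coef q' i  ≡⟨ coef-+ p' q' i ⟨
  coef (p' +ₚ q') i        ∎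
  where open ≡-Reasoning

+ₚ-comm : ∀ p q → p +ₚ q ~ q +ₚ p
+ₚ-comm p q = coeffwise λ i →
  trans (coef-+ p q i) (trans (xor-comm (coef p i) _) (sym (coef-+ q p i)))

+ₚ-assoc : ∀ p q r → (p +ₚ q) +ₚ r ~ p +ₚ (q +ₚ r)
+ₚ-assoc p q r = coeffwise λ i → begin
  coef ((p +ₚ q) +ₚ r) i                  ≡⟨ coef-+ (p +ₚ q) r i ⟩
  coef (p +ₚ q) i xor coef r i            ≡⟨ cong (_xor coef r i) (coef-+ p q i) ⟩
  (coef p i xor coef q i) xor coef r i    ≡⟨ xor-assoc (coef p i) _ _ ⟩
  coef p i xor (coef q i xor coef r i)    ≡⟨ cong (coef p i xor_) (coef-+ q r i) ⟨
  coef p i xor coef (q +ₚ r) i            ≡⟨ coef-+ p (q +ₚ r) i ⟨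
  coef (p +ₚ (q +ₚ r)) i                  ∎
  where open ≡-Reasoning

+ₚ-self : ∀ p → Zero (p +ₚ p)
+ₚ-self p = coeffwise λ i → trans (coef-+ p p i) (xor-same (coef p i))

+ₚ-identityʳ : ∀ p → p +ₚ [] ~ p
+ₚ-identityʳ p = coeffwise λ i → trans (coef-+ p [] i) (xor-identityʳ (coef p i))

+ₚ-zeroʳ : ∀ {p q} → Zero q → p +ₚ q ~ p
+ₚ-zeroʳ {p} z = ~-trans (+ₚ-cong (~-refl {p}) z) (+ₚ-identityʳ p)

+ₚ-zeroˡ : ∀ {p q} → Zero p → p +ₚ q ~ q
+ₚ-zeroˡ z = +ₚ-cong z ~-refl

+ₚ-cancelˡ : ∀ p q → p +ₚ (p +ₚ q) ~ q
+ₚ-cancelˡ p q = ~-trans (~-sym (+ₚ-assoc p p q)) (+ₚ-zeroˡ (+ₚ-self p))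

+ₚ≈0⇒≈ : ∀ {p q} → Zero (p +ₚ q) → p ~ q
+ₚ≈0⇒≈ {p} {q} z = begin
  p                 ≈⟨ +ₚ-zeroʳ (+ₚ-self q) ⟨
  p +ₚ (q +ₚ q)     ≈⟨ +ₚ-assoc p q q ⟨
  (p +ₚ q) +ₚ q     ≈⟨ +ₚ-zeroˡ z ⟩
  q                 ∎
  where open ~-Reasoning

+ₚ-interchange : ∀ p q r s → (p +ₚ q) +ₚ (r +ₚ s) ~ (p +ₚ r) +ₚ (q +ₚ s)
+ₚ-interchange p q r s = begin
  (p +ₚ q) +ₚ (r +ₚ s)   ≈⟨ +ₚ-assoc p q (r +ₚ s) ⟩
  p +ₚ (q +ₚ (r +ₚ s))   ≈⟨ +ₚ-cong (~-refl {p}) (~-sym (+ₚ-assoc q r s)) ⟩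
  p +ₚ ((q +ₚ r) +ₚ s)   ≈⟨ +ₚ-cong (~-refl {p}) (+ₚ-cong (+ₚ-comm q r) (~-refl {s})) ⟩
  p +ₚ ((r +ₚ q) +ₚ s)   ≈⟨ +ₚ-cong (~-refl {p}) (+ₚ-assoc r q s) ⟩
  p +ₚ (r +ₚ (q +ₚ s))   ≈⟨ ~-sym (+ₚ-assoc p r (q +ₚ s)) ⟩
  (p +ₚ r) +ₚ (q +ₚ s)   ∎
  where open ~-Reasoning

scale-cong : ∀ a {q q'} → q ~ q' → scale a q ~ scale a q'
scale-cong a {q} {q'} e = coeffwise λ i →
  trans (coef-scale a q i) (trans (cong (a ∧_) (at e i)) (sym (coef-scale a q' i)))

scale-false : ∀ q → Zero (scale false q)
scale-false q = coeffwise (coef-scale false q)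

scale-true : ∀ q → scale true q ~ q
scale-true q = coeffwise (coef-scale true q)

scale-+ : ∀ a q r → scale a (q +ₚ r) ~ scale a q +ₚ scale a r
scale-+ true  q r = ~-trans (scale-true (q +ₚ r)) (~-sym (+ₚ-cong (scale-true q) (scale-true r)))
scale-+ false q r =
  ~-trans (scale-false (q +ₚ r)) (~-sym (~-trans (+ₚ-zeroˡ (scale-false q)) (scale-false r)))

scale-∧ : ∀ a b q → scale a (scale b q) ~ scale (a ∧ b) q
scale-∧ a b q = coeffwise λ i →
  trans (coef-scale a (scale b q) i)
    (trans (cong (a ∧_) (coef-scale b q i))
      (trans (sym (∧-assoc a b _)) (sym (coef-scale (a ∧ b) q i))))

-- Multiplication, defined by recursion on the left factor; commutativity
-- comes first, so that every law needs to be proved on one side only.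

*ₚ-congʳ : ∀ p {q q'} → q ~ q' → p *ₚ q ~ p *ₚ q'
*ₚ-congʳ []      e = ~-refl
*ₚ-congʳ (a ∷ p) e = +ₚ-cong (scale-cong a e) (∷-cong refl (*ₚ-congʳ p e))

shift-*ₚ : ∀ s r → (false ∷ s) *ₚ r ~ false ∷ (s *ₚ r)
shift-*ₚ s r = +ₚ-zeroˡ (scale-false r)

*ₚ-nilʳ : ∀ p → Zero (p *ₚ [])
*ₚ-nilʳ []      = ~-refl
*ₚ-nilʳ (a ∷ p) = ~-trans (∷-cong refl (*ₚ-nilʳ p)) (coeffwise λ { zero → refl ; (suc i) → refl })

*ₚ-∷ʳ : ∀ q a p → q *ₚ (a ∷ p) ~ scale a q +ₚ (false ∷ (q *ₚ p))
*ₚ-∷ʳ []      a p = coeffwise λ { zero → refl ; (suc i) → refl }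
*ₚ-∷ʳ (b ∷ q) a p = begin
  scale b (a ∷ p) +ₚ (false ∷ (q *ₚ (a ∷ p)))
    ≈⟨ +ₚ-cong (~-refl {scale b (a ∷ p)}) (∷-cong refl (*ₚ-∷ʳ q a p)) ⟩
  scale b (a ∷ p) +ₚ (false ∷ (scale a q +ₚ (false ∷ (q *ₚ p))))
    ≈⟨ ∷-cong (cong (_xor false) (∧-comm b a)) (swap (scale b p) (scale a q) (false ∷ (q *ₚ p))) ⟩
  scale a (b ∷ q) +ₚ (false ∷ (scale b p +ₚ (false ∷ (q *ₚ p)))) ∎
  where
  open ~-Reasoning
  swap : ∀ u v w → u +ₚ (v +ₚ w) ~ v +ₚ (u +ₚ w)
  swap u v w = ~-trans (~-sym (+ₚ-assoc u v w))
                 (~-trans (+ₚ-cong (+ₚ-comm u v) (~-refl {w})) (+ₚ-assoc v u w))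

*ₚ-comm : ∀ p q → p *ₚ q ~ q *ₚ p
*ₚ-comm []      q = ~-sym (*ₚ-nilʳ q)
*ₚ-comm (a ∷ p) q = ~-trans (+ₚ-cong (~-refl {scale a q}) (∷-cong refl (*ₚ-comm p q))) (~-sym (*ₚ-∷ʳ q a p))

*ₚ-congˡ : ∀ {p p'} q → p ~ p' → p *ₚ q ~ p' *ₚ q
*ₚ-congˡ {p} {p'} q e = ~-trans (*ₚ-comm p q) (~-trans (*ₚ-congʳ q e) (*ₚ-comm q p'))

*ₚ-cong : ∀ {p p' q q'} → p ~ p' → q ~ q' → p *ₚ q ~ p' *ₚ q'
*ₚ-cong {p' = p'} {q = q} e f = ~-trans (*ₚ-congˡ q e) (*ₚ-congʳ p' f)

*ₚ-distribˡ : ∀ p q r → p *ₚ (q +ₚ r) ~ p *ₚ q +ₚ p *ₚ r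
*ₚ-distribˡ []      q r = ~-refl
*ₚ-distribˡ (a ∷ p) q r =
  ~-trans (+ₚ-cong (scale-+ a q r) (∷-cong {false} {false xor false} refl (*ₚ-distribˡ p q r)))
          (+ₚ-interchange (scale a q) (scale a r) (false ∷ (p *ₚ q)) (false ∷ (p *ₚ r)))

*ₚ-distribʳ : ∀ p q r → (p +ₚ q) *ₚ r ~ p *ₚ r +ₚ q *ₚ r
*ₚ-distribʳ p q r =
  ~-trans (*ₚ-comm (p +ₚ q) r) (~-trans (*ₚ-distribˡ r p q) (+ₚ-cong (*ₚ-comm r p) (*ₚ-comm r q)))

scale-* : ∀ a q r → scale a q *ₚ r ~ scale a (q *ₚ r)
scale-* a []      r = ~-refl
scale-* a (b ∷ q) r = begin
  scale (a ∧ b) r +ₚ (false ∷ (scale a q *ₚ r))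
    ≈⟨ +ₚ-cong (~-sym (scale-∧ a b r)) (∷-cong refl (scale-* a q r)) ⟩
  scale a (scale b r) +ₚ (false ∷ scale a (q *ₚ r))
    ≈⟨ +ₚ-cong (~-refl {scale a (scale b r)}) (∷-cong (∧-zeroʳ a) ~-refl) ⟨
  scale a (scale b r) +ₚ scale a (false ∷ (q *ₚ r))
    ≈⟨ scale-+ a (scale b r) (false ∷ (q *ₚ r)) ⟨
  scale a (scale b r +ₚ (false ∷ (q *ₚ r))) ∎
  where open ~-Reasoning

*ₚ-assoc : ∀ p q r → (p *ₚ q) *ₚ r ~ p *ₚ (q *ₚ r)
*ₚ-assoc []      q r = ~-refl
*ₚ-assoc (a ∷ p) q r =
  ~-trans (*ₚ-distribʳ (scale a q) (false ∷ (p *ₚ q)) r)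
    (+ₚ-cong (scale-* a q r) (~-trans (shift-*ₚ (p *ₚ q) r) (∷-cong refl (*ₚ-assoc p q r))))

*ₚ-identityˡ : ∀ p → 1ₚ *ₚ p ~ p
*ₚ-identityˡ p = ~-trans (+ₚ-cong (scale-true p) (coeffwise λ { zero → refl ; (suc i) → refl })) (+ₚ-identityʳ p)

*ₚ-identityʳ : ∀ p → p *ₚ 1ₚ ~ p
*ₚ-identityʳ p = ~-trans (*ₚ-comm p 1ₚ) (*ₚ-identityˡ p)

*ₚ-zeroʳ : ∀ p {q} → Zero q → Zero (p *ₚ q)
*ₚ-zeroʳ p z = ~-trans (*ₚ-congʳ p z) (*ₚ-nilʳ p)

-- Trimmed p: p is a nonzero coefficient list without trailing zeros,
-- i.e. its last coefficient is 1.  Together with [] these are exactly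
-- the canonical representatives produced by norm.
data Trimmed : Poly → Set where
  [1]  : Trimmed (true ∷ [])
  _∷ᵗ_ : ∀ b {p} → Trimmed p → Trimmed (b ∷ p)

Canonical : Poly → Set
Canonical p = p ≡ [] ⊎ Trimmed p

trimmed-nonzero : ∀ {p} → Trimmed p → ¬ Zero p
trimmed-nonzero [1]      z = case zero-head z of λ ()
trimmed-nonzero (b ∷ᵗ t) z = trimmed-nonzero t (zero-tail z)

trimmed-length : ∀ {p} → Trimmed p → 1 ≤ length p
trimmed-length [1]      = s≤s z≤n
trimmed-length (b ∷ᵗ t) = s≤s z≤n

trimmed-unique : ∀ {p q} → Trimmed p → Trimmed q → p ~ q → p ≡ q
trimmed-unique [1]      [1]      e = refl
trimmed-unique [1]      (b ∷ᵗ t) e = ⊥-elim (trimmed-nonzero t (~-sym (∷-tail e)))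
trimmed-unique (a ∷ᵗ t) [1]      e = ⊥-elim (trimmed-nonzero t (∷-tail e))
trimmed-unique (a ∷ᵗ t) (b ∷ᵗ u) e = cong₂ _∷_ (∷-head e) (trimmed-unique t u (∷-tail e))

canonical-unique : ∀ {p q} → Canonical p → Canonical q → p ~ q → p ≡ q
canonical-unique (inj₁ refl) (inj₁ refl) e = refl
canonical-unique (inj₁ refl) (inj₂ u)    e = ⊥-elim (trimmed-nonzero u (~-sym e))
canonical-unique (inj₂ t)    (inj₁ refl) e = ⊥-elim (trimmed-nonzero t e)
canonical-unique (inj₂ t)    (inj₂ u)    e = trimmed-unique t u e

norm-~ : ∀ p → norm p ~ p
norm-~ []      = ~-refl
norm-~ (b ∷ p) with norm p | norm-~ p
norm-~ (true  ∷ p) | []    | e = ∷-cong refl e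
norm-~ (false ∷ p) | []    | e = ~-sym (zero-∷ (~-sym e))
...                | c ∷ q | e = ∷-cong refl e

norm-canonical : ∀ p → Canonical (norm p)
norm-canonical []      = inj₁ refl
norm-canonical (b ∷ p) with norm p | norm-canonical p
norm-canonical (true  ∷ p) | [] | _ = inj₂ [1]
norm-canonical (false ∷ p) | [] | _ = inj₁ refl
... | c ∷ q | inj₂ t = inj₂ (b ∷ᵗ t)

~⇒≈ₚ : ∀ {p q} → p ~ q → p ≈ₚ q
~⇒≈ₚ {p} {q} e = canonical-unique (norm-canonical p) (norm-canonical q)
  (~-trans (norm-~ p) (~-trans e (~-sym (norm-~ q))))

≈ₚ⇒~ : ∀ {p q} → p ≈ₚ q → p ~ q
≈ₚ⇒~ {p} {q} eq = ~-trans (~-sym (norm-~ p)) (subst (_~ q) (sym eq) (norm-~ q))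

norm-trimmed : ∀ {p} → Trimmed p → norm p ≡ p
norm-trimmed {p} t = canonical-unique (norm-canonical p) (inj₂ t) (norm-~ p)

norm-nonzero : ∀ {p} → ¬ Zero p → Trimmed (norm p)
norm-nonzero {p} nz with norm p | norm-canonical p | norm-~ p
... | _ | inj₁ refl | e = ⊥-elim (nz (~-sym e))
... | _ | inj₂ t    | e = t

-- len p: number of coefficients up to the leading one, i.e. deg p + 1
-- (and 0 for the zero polynomial).
len : Poly → ℕ
len p = length (norm p)

len-cong : ∀ {p q} → p ~ q → len p ≡ len q
len-cong e = cong length (~⇒≈ₚ e)

len≡0⇒zero : ∀ {p} → len p ≡ 0 → Zero p
len≡0⇒zero {p} e with norm p | norm-~ p
... | [] | n = ~-sym n

zero⇒len≡0 : ∀ {p} → Zero p → len p ≡ 0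
zero⇒len≡0 = len-cong

len-nonzero : ∀ {p} → ¬ Zero p → 1 ≤ len p
len-nonzero nz = trimmed-length (norm-nonzero nz)

len-trimmed : ∀ {p} → Trimmed p → len p ≡ length p
len-trimmed t = cong length (norm-trimmed t)

len-∷ : ∀ c r → len (c ∷ r) ≤ suc (len r)
len-∷ c r with norm r
len-∷ true  r | [] = s≤s z≤n
len-∷ false r | [] = z≤n
...           | _ ∷ _ = ≤-refl

norm-shortens : ∀ p → len p ≤ length p
norm-shortens []      = z≤n
norm-shortens (c ∷ p) = ≤-trans (len-∷ c p) (s≤s (norm-shortens p))

+ₚ-shorter : ∀ r {s} → Trimmed s → length r < length s →
            Trimmed (r +ₚ s) × length (r +ₚ s) ≡ length s
+ₚ-shorter []      t         _         = t , refl
+ₚ-shorter (a ∷ r) [1]       (s≤s ())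
+ₚ-shorter (a ∷ r) (c ∷ᵗ t) (s≤s lt) with +ₚ-shorter r t lt
... | t' , eq = (a xor c) ∷ᵗ t' , cong suc eq

1*-trimmed : ∀ {q} → Trimmed q → 1ₚ *ₚ q ≡ q
1*-trimmed {c ∷ q} _ = cong₂ _∷_ (xor-identityʳ c) (trans (+nil (scale true q)) (scale-true-≡ q))
  where
  +nil : ∀ q → q +ₚ [] ≡ q
  +nil []      = refl
  +nil (c ∷ q) = refl
  scale-true-≡ : ∀ q → scale true q ≡ q
  scale-true-≡ []      = refl
  scale-true-≡ (c ∷ q) = cong (c ∷_) (scale-true-≡ q)

*ₚ-trimmed : ∀ {p q} → Trimmed p → Trimmed q →
            Trimmed (p *ₚ q) × suc (length (p *ₚ q)) ≡ length p + length q
*ₚ-trimmed {q = q} [1] u rewrite 1*-trimmed u = u , refl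
*ₚ-trimmed {b ∷ p} {q} (b ∷ᵗ t) u with *ₚ-trimmed t u
... | tpq , eq with +ₚ-shorter (scale b q) (false ∷ᵗ tpq) (shorter eq)
  where
  shorter : suc (length (p *ₚ q)) ≡ length p + length q → length (scale b q) < suc (length (p *ₚ q))
  shorter eq rewrite length-map (b ∧_) q =
    subst (suc (length q) ≤_) (sym eq) (+-monoˡ-≤ (length q) (trimmed-length t))
... | t' , eq' = t' , cong suc (trans eq' eq)

len-* : ∀ {p q} → ¬ Zero p → ¬ Zero q → suc (len (p *ₚ q)) ≡ len p + len q
len-* {p} {q} np nq with *ₚ-trimmed (norm-nonzero np) (norm-nonzero nq)
... | t , eq = trans (cong suc (trans (len-cong (*ₚ-cong (~-sym (norm-~ p)) (~-sym (norm-~ q))))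
                                       (len-trimmed t))) eq

*ₚ-nonzero : ∀ {p q} → ¬ Zero p → ¬ Zero q → ¬ Zero (p *ₚ q)
*ₚ-nonzero {p} {q} np nq z = <-irrefl refl (subst (1 <_) (sym eq) (+-mono-≤ (len-nonzero np) (len-nonzero nq)))
  where
  eq : 1 ≡ len p + len q
  eq = trans (cong suc (sym (zero⇒len≡0 z))) (len-* np nq)

isZero-sound : ∀ p → isZero p ≡ true → Zero p
isZero-sound p h with norm p | norm-~ p
... | [] | e = ~-sym e

isZero-complete : ∀ p → Zero p → isZero p ≡ true
isZero-complete p z with norm p | ~⇒≈ₚ z
... | [] | _ = refl

isZero-nonzero : ∀ p → ¬ Zero p → isZero p ≡ false
isZero-nonzero p nz with isZero p in h
... | true  = ⊥-elim (nz (isZero-sound p h))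
... | false = refl

zero? : ∀ p → Dec (Zero p)
zero? p with isZero p in h
... | true  = yes (isZero-sound p h)
... | false = no λ z → case trans (sym h) (isZero-complete p z) of λ ()

len-pos⇒nonzero : ∀ {p} → 1 ≤ len p → ¬ Zero p
len-pos⇒nonzero {p} 1≤p z = <-irrefl (sym (zero⇒len≡0 z)) 1≤p

infix 4 _∣_
record _∣_ (d p : Poly) : Set where
  constructor divides
  field
    quotient : Poly
    equation : d *ₚ quotient ~ p
open _∣_ public

∣-respʳ : ∀ {d p p'} → p ~ p' → d ∣ p → d ∣ p'
∣-respʳ e (divides c f) = divides c (~-trans f e)

∣-respˡ : ∀ {d d' p} → d ~ d' → d ∣ p → d' ∣ p
∣-respˡ e (divides c f) = divides c (~-trans (*ₚ-congˡ c (~-sym e)) f)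

∣-refl : ∀ {d} → d ∣ d
∣-refl {d} = divides 1ₚ (*ₚ-identityʳ d)

∣-zero : ∀ {d p} → Zero p → d ∣ p
∣-zero {d} z = divides [] (~-trans (*ₚ-nilʳ d) (~-sym z))

∣-+ : ∀ {d p q} → d ∣ p → d ∣ q → d ∣ (p +ₚ q)
∣-+ {d} (divides c f) (divides c' f') = divides (c +ₚ c') (~-trans (*ₚ-distribˡ d c c') (+ₚ-cong f f'))

∣-*ˡ : ∀ {d} p {q} → d ∣ q → d ∣ (p *ₚ q)
∣-*ˡ {d} p (divides c f) = divides (p *ₚ c) (begin
  d *ₚ (p *ₚ c)   ≈⟨ *ₚ-assoc d p c ⟨
  (d *ₚ p) *ₚ c   ≈⟨ *ₚ-congˡ c (*ₚ-comm d p) ⟩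
  (p *ₚ d) *ₚ c   ≈⟨ *ₚ-assoc p d c ⟩
  p *ₚ (d *ₚ c)   ≈⟨ *ₚ-congʳ p f ⟩
  p *ₚ _          ∎)
  where open ~-Reasoning

∣-*ʳ : ∀ {d p} q → d ∣ p → d ∣ (p *ₚ q)
∣-*ʳ {d} {p} q dp = ∣-respʳ (*ₚ-comm q p) (∣-*ˡ q dp)

∣-shift : ∀ k {d p} → d ∣ p → d ∣ shift k p
∣-shift zero    dp = dp
∣-shift (suc k) {d} dp = ∣-respʳ (~-trans (shift-*ₚ 1ₚ _) (∷-cong refl (*ₚ-identityˡ _)))
                                  (∣-*ˡ (false ∷ 1ₚ) (∣-shift k dp))

∣-len : ∀ {d r} → d ∣ r → ¬ Zero r → len d ≤ len r
∣-len {d} {r} (divides c f) nzr = ≤-pred (begin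
  suc (len d)     ≡⟨ +-comm 1 (len d) ⟩
  len d + 1       ≤⟨ +-monoʳ-≤ (len d) (len-nonzero nzc) ⟩
  len d + len c   ≡⟨ eq ⟩
  suc (len r)     ∎)
  where
  open ≤-Reasoning
  nzd : ¬ Zero d
  nzd z = nzr (~-trans (~-sym f) (*ₚ-congˡ c z))
  nzc : ¬ Zero c
  nzc z = nzr (~-trans (~-sym f) (*ₚ-zeroʳ d z))
  eq : len d + len c ≡ suc (len r)
  eq = sym (trans (cong suc (sym (len-cong f))) (len-* nzd nzc))

+ₚ-same-length : ∀ {p q} → Trimmed p → Trimmed q → length p ≡ length q → len (p +ₚ q) < length p
+ₚ-same-length [1]      [1]      e = s≤s z≤n
+ₚ-same-length [1]      (b ∷ᵗ u) e = ⊥-elim (<-irrefl (suc-injective e) (trimmed-length u))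
+ₚ-same-length (a ∷ᵗ t) [1]      e = ⊥-elim (<-irrefl (sym (suc-injective e)) (trimmed-length t))
+ₚ-same-length {a ∷ p} {b ∷ q} (a ∷ᵗ t) (b ∷ᵗ u) e =
  ≤-<-trans (len-∷ (a xor b) (p +ₚ q)) (s≤s (+ₚ-same-length t u (suc-injective e)))

trimmed-shift : ∀ k {b} → Trimmed b → Trimmed (shift k b)
trimmed-shift zero    t = t
trimmed-shift (suc k) t = false ∷ᵗ trimmed-shift k t

length-shift : ∀ k b → length (shift k b) ≡ k + length b
length-shift zero    b = refl
length-shift (suc k) b = cong suc (length-shift k b)

reduce : Poly → Poly → Poly
reduce a b = a +ₚ shift (length a ∸ length b) b

reduce-shorter : ∀ {a b} → Trimmed a → Trimmed b → length b ≤ length a → len (reduce a b) < length a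
reduce-shorter {a} {b} ta tb b≤a = +ₚ-same-length ta (trimmed-shift k tb) (sym same)
  where
  k = length a ∸ length b
  same : length (shift k b) ≡ length a
  same = trans (length-shift k b) (trans (+-comm k (length b)) (m+[n∸m]≡n b≤a))

mod-fuel-correct : ∀ f a b → ¬ Zero b → len a ≤ f →
  length (modₚ-fuel f a b) < len b × b ∣ (a +ₚ modₚ-fuel f a b)
mod-fuel-correct zero a b nzb la≤0 =
  ≤-trans (s≤s la≤0) (len-nonzero nzb) , ∣-zero (~-trans (+ₚ-cong (~-refl {a}) (norm-~ a)) (+ₚ-self a))
mod-fuel-correct (suc f) a b nzb la≤f
  with norm a | norm-~ a | norm-canonical a | la≤f | norm b | norm-~ b | norm-canonical b
... | a' | a'~a | ca | la'≤f | b' | b'~b | cb with length a' <ᵇ length b' in a'<b'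
...   | true  = <ᵇ⇒< (length a') (length b') (subst T (sym a'<b') tt)
              , ∣-zero (~-trans (+ₚ-cong (~-refl {a}) a'~a) (+ₚ-self a))
...   | false with cb
...     | inj₁ refl = ⊥-elim (nzb (~-sym b'~b))
...     | inj₂ tb with ca
...       | inj₁ refl = ⊥-elim (subst T a'<b' (<⇒<ᵇ (trimmed-length tb)))
...       | inj₂ ta = subst (λ w → length r < length w) nb≡b' (proj₁ ih)
                    , ∣-respʳ rearrange (∣-+ (proj₂ ih) step)
  where
  nb≡b' : norm b ≡ b'
  nb≡b' = trans (~⇒≈ₚ (~-sym b'~b)) (norm-trimmed tb)
  s = shift (length a' ∸ length b') b'
  r = modₚ-fuel f (reduce a' b') b
  b'≤a' : length b' ≤ length a'
  b'≤a' = ≮⇒≥ (λ lt → subst T a'<b' (<⇒<ᵇ lt))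
  ih = mod-fuel-correct f (reduce a' b') b nzb (≤-pred (≤-trans (reduce-shorter ta tb b'≤a') la'≤f))
  step : b ∣ s
  step = ∣-shift (length a' ∸ length b') (∣-respʳ (~-sym b'~b) ∣-refl)
  rearrange : ((a' +ₚ s) +ₚ r) +ₚ s ~ a +ₚ r
  rearrange = begin
    ((a' +ₚ s) +ₚ r) +ₚ s   ≈⟨ +ₚ-assoc (a' +ₚ s) r s ⟩
    (a' +ₚ s) +ₚ (r +ₚ s)   ≈⟨ +ₚ-cong (~-refl {a' +ₚ s}) (+ₚ-comm r s) ⟩
    (a' +ₚ s) +ₚ (s +ₚ r)   ≈⟨ +ₚ-assoc a' s (s +ₚ r) ⟩
    a' +ₚ (s +ₚ (s +ₚ r))   ≈⟨ +ₚ-cong a'~a (+ₚ-cancelˡ s r) ⟩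
    a +ₚ r                  ∎
    where open ~-Reasoning

remainder-correct : ∀ a b → ¬ Zero b → len (a modₚ b) < len b × b ∣ (a +ₚ (a modₚ b))
remainder-correct a b nzb with mod-fuel-correct (length a) a b nzb (norm-shortens a)
... | lt , d = ≤-<-trans (norm-shortens (a modₚ b)) lt , d

divides?-sound : ∀ {d A} → ¬ Zero d → divides? d A ≡ true → d ∣ A
divides?-sound {d} {A} nzd h rewrite isZero-nonzero d nzd =
  ∣-respʳ (+ₚ-zeroʳ (isZero-sound (A modₚ d) h)) (proj₂ (remainder-correct A d nzd))

divides?-complete : ∀ {d A} → ¬ Zero d → d ∣ A → divides? d A ≡ true
divides?-complete {d} {A} nzd dA rewrite isZero-nonzero d nzd with zero? (A modₚ d)
... | yes z  = isZero-complete (A modₚ d) z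
... | no nzr = ⊥-elim (<-irrefl refl (≤-<-trans (∣-len d∣r nzr) (proj₁ (remainder-correct A d nzd))))
  where
  -- the remainder is a multiple of d shorter than d
  d∣r : d ∣ A modₚ d
  d∣r = ∣-respʳ (+ₚ-cancelˡ A _) (∣-+ dA (proj₂ (remainder-correct A d nzd)))

len≡1 : ∀ {d} → ¬ Zero d → len d ≡ 1 → d ~ 1ₚ
len≡1 {d} nz eq = ≈ₚ⇒~ (unit (norm-nonzero nz) eq)
  where
  unit : ∀ {p} → Trimmed p → length p ≡ 1 → p ≡ 1ₚ
  unit [1]      _ = refl
  unit (b ∷ᵗ t) e = ⊥-elim (<-irrefl (sym (suc-injective e)) (trimmed-length t))

*ₚ-cancelˡ : ∀ {c x y} → ¬ Zero c → c *ₚ x ~ c *ₚ y → x ~ y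
*ₚ-cancelˡ {c} {x} {y} nzc e with zero? (x +ₚ y)
... | yes z  = +ₚ≈0⇒≈ z
... | no nz = ⊥-elim (*ₚ-nonzero nzc nz (begin
  c *ₚ (x +ₚ y)          ≈⟨ *ₚ-distribˡ c x y ⟩
  c *ₚ x +ₚ c *ₚ y       ≈⟨ +ₚ-cong e (~-refl {c *ₚ y}) ⟩
  c *ₚ y +ₚ c *ₚ y       ≈⟨ +ₚ-self (c *ₚ y) ⟩
  []                     ∎))
  where open ~-Reasoning

record Irreducible (P : Poly) : Set where
  field
    nonconstant      : 2 ≤ len P
    no-proper-factor : ∀ a → 2 ≤ len a → len a < len P → ¬ (a ∣ P)

module _ {P : Poly} (irr : Irreducible P) where
  open Irreducible irr

  irreducible-nonzero : ¬ Zero P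
  irreducible-nonzero = len-pos⇒nonzero (<⇒≤ nonconstant)

  -- P divides no product of two nonzero polynomials shorter than P.
  -- Induction on len a (bounded by k): the remainder r of P modulo a is
  -- shorter than a, nonzero because P has no proper factor, and P ∣ r b.
  no-short-product : ∀ k a b → len a ≤ k → ¬ Zero a → ¬ Zero b →
                     len a < len P → len b < len P → ¬ (P ∣ a *ₚ b)
  no-short-product zero    a b la≤0 nza _ _ _ _ = nza (len≡0⇒zero (n≤0⇒n≡0 la≤0))
  no-short-product (suc k) a b la≤k nza nzb la<P lb<P P∣ab with len a ≤? 1
  ... | yes la≤1 = <⇒≱ lb<P (∣-len (∣-respʳ ab≈b P∣ab) nzb)
    where
    ab≈b : a *ₚ b ~ b
    ab≈b = ~-trans (*ₚ-congˡ b (len≡1 nza (≤-antisym la≤1 (len-nonzero nza)))) (*ₚ-identityˡ b)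
  ... | no la≰1 with remainder-correct P a nza | zero? (P modₚ a)
  ...   | _ , a∣P+r | yes z = no-proper-factor a (≰⇒> la≰1) la<P (∣-respʳ (+ₚ-zeroʳ z) a∣P+r)
  ...   | lr<la , divides c ac≈P+r | no nzr =
    no-short-product k r b (≤-pred (≤-trans lr<la la≤k)) nzr nzb (<-trans lr<la la<P) lb<P P∣rb
    where
    r = P modₚ a
    rb≈ : r *ₚ b ~ P *ₚ b +ₚ c *ₚ (a *ₚ b)
    rb≈ = begin
      r *ₚ b                        ≈⟨ *ₚ-congˡ b (+ₚ-cancelˡ P r) ⟨
      (P +ₚ (P +ₚ r)) *ₚ b          ≈⟨ *ₚ-congˡ b (+ₚ-cong (~-refl {P}) ac≈P+r) ⟨
      (P +ₚ a *ₚ c) *ₚ b            ≈⟨ *ₚ-distribʳ P (a *ₚ c) b ⟩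
      P *ₚ b +ₚ (a *ₚ c) *ₚ b       ≈⟨ +ₚ-cong (~-refl {P *ₚ b}) (*ₚ-congˡ b (*ₚ-comm a c)) ⟩
      P *ₚ b +ₚ (c *ₚ a) *ₚ b       ≈⟨ +ₚ-cong (~-refl {P *ₚ b}) (*ₚ-assoc c a b) ⟩
      P *ₚ b +ₚ c *ₚ (a *ₚ b)       ∎
      where open ~-Reasoning
    P∣rb : P ∣ r *ₚ b
    P∣rb = ∣-respʳ (~-sym rb≈) (∣-+ (∣-*ʳ b ∣-refl) (∣-*ˡ c P∣ab))

  -- Euclid's lemma: an irreducible polynomial is prime.  Reduce a and b
  -- modulo P; if neither remainder vanishes, P divides their product.
  irreducible-prime : ∀ a b → P ∣ a *ₚ b → P ∣ a ⊎ P ∣ b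
  irreducible-prime a b P∣ab
    with remainder-correct a P irreducible-nonzero | remainder-correct b P irreducible-nonzero
       | zero? (a modₚ P) | zero? (b modₚ P)
  ... | _ , P∣a+ra | _ | yes z | _ = inj₁ (∣-respʳ (+ₚ-zeroʳ z) P∣a+ra)
  ... | _ | _ , P∣b+rb | no _ | yes z = inj₂ (∣-respʳ (+ₚ-zeroʳ z) P∣b+rb)
  ... | la<P , P∣a+ra | lb<P , P∣b+rb | no nza | no nzb =
    ⊥-elim (no-short-product (len ra) ra rb ≤-refl nza nzb la<P lb<P P∣rarb)
    where
    ra = a modₚ P
    rb = b modₚ P
    u = a +ₚ ra
    v = b +ₚ rb
    rarb≈ : ra *ₚ rb ~ (a *ₚ b +ₚ a *ₚ v) +ₚ u *ₚ (b +ₚ v)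
    rarb≈ = begin
      ra *ₚ rb                              ≈⟨ *ₚ-cong (+ₚ-cancelˡ a ra) (+ₚ-cancelˡ b rb) ⟨
      (a +ₚ u) *ₚ (b +ₚ v)                  ≈⟨ *ₚ-distribʳ a u (b +ₚ v) ⟩
      a *ₚ (b +ₚ v) +ₚ u *ₚ (b +ₚ v)        ≈⟨ +ₚ-cong (*ₚ-distribˡ a b v) (~-refl {u *ₚ (b +ₚ v)}) ⟩
      (a *ₚ b +ₚ a *ₚ v) +ₚ u *ₚ (b +ₚ v)   ∎
      where open ~-Reasoning
    P∣rarb : P ∣ ra *ₚ rb
    P∣rarb = ∣-respʳ (~-sym rarb≈) (∣-+ (∣-+ P∣ab (∣-*ˡ a P∣b+rb)) (∣-*ʳ (b +ₚ v) P∣a+ra))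

  -- the divisors of a power of an irreducible polynomial are its powers:
  -- P divides d or the cofactor, and cancelling P lowers the exponent
  divisor-of-power : ∀ n d → ¬ Zero d → d ∣ P ^ₚ n → Σ ℕ λ j → j ≤ n × d ~ P ^ₚ j
  divisor-of-power zero    d nzd d∣1 =
    0 , z≤n , len≡1 nzd (≤-antisym (∣-len d∣1 (trimmed-nonzero [1])) (len-nonzero nzd))
  divisor-of-power (suc n) d nzd (divides e de≈PPⁿ)
    with irreducible-prime d e (divides (P ^ₚ n) (~-sym de≈PPⁿ))
  ... | inj₁ (divides d' Pd'≈d) with divisor-of-power n d' nzd' (divides e (*ₚ-cancelˡ irreducible-nonzero Pd'e≈PPⁿ))
    where
    nzd' : ¬ Zero d'
    nzd' z = nzd (~-trans (~-sym Pd'≈d) (*ₚ-zeroʳ P z))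
    Pd'e≈PPⁿ : P *ₚ (d' *ₚ e) ~ P *ₚ (P ^ₚ n)
    Pd'e≈PPⁿ = ~-trans (~-sym (*ₚ-assoc P d' e)) (~-trans (*ₚ-congˡ e Pd'≈d) de≈PPⁿ)
  ...   | j , j≤n , d'≈Pʲ = suc j , s≤s j≤n , ~-trans (~-sym Pd'≈d) (*ₚ-congʳ P d'≈Pʲ)
  divisor-of-power (suc n) d nzd (divides e de≈PPⁿ)
      | inj₂ (divides e' Pe'≈e) with divisor-of-power n d nzd (divides e' (*ₚ-cancelˡ irreducible-nonzero Pde'≈PPⁿ))
    where
    Pde'≈PPⁿ : P *ₚ (d *ₚ e') ~ P *ₚ (P ^ₚ n)
    Pde'≈PPⁿ = begin
      P *ₚ (d *ₚ e')   ≈⟨ *ₚ-assoc P d e' ⟨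
      (P *ₚ d) *ₚ e'   ≈⟨ *ₚ-congˡ e' (*ₚ-comm P d) ⟩
      (d *ₚ P) *ₚ e'   ≈⟨ *ₚ-assoc d P e' ⟩
      d *ₚ (P *ₚ e')   ≈⟨ *ₚ-congʳ d Pe'≈e ⟩
      d *ₚ e           ≈⟨ de≈PPⁿ ⟩
      P *ₚ (P ^ₚ n)    ∎
      where open ~-Reasoning
  ...   | j , j≤n , d≈Pʲ = j , m≤n⇒m≤1+n j≤n , d≈Pʲ

^-+ : ∀ P j k → P ^ₚ (j + k) ~ (P ^ₚ j) *ₚ (P ^ₚ k)
^-+ P zero    k = ~-sym (*ₚ-identityˡ _)
^-+ P (suc j) k = ~-trans (*ₚ-congʳ P (^-+ P j k)) (~-sym (*ₚ-assoc P (P ^ₚ j) (P ^ₚ k)))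

power-divides : ∀ P {j n} → j ≤ n → P ^ₚ j ∣ P ^ₚ n
power-divides P {j} {n} j≤n = divides (P ^ₚ (n ∸ j)) (begin
  P ^ₚ j *ₚ P ^ₚ (n ∸ j)   ≈⟨ ^-+ P j (n ∸ j) ⟨
  P ^ₚ (j + (n ∸ j))       ≡⟨ cong (P ^ₚ_) (m+[n∸m]≡n j≤n) ⟩
  P ^ₚ n                   ∎)
  where open ~-Reasoning

^-nonzero : ∀ {P} → ¬ Zero P → ∀ j → ¬ Zero (P ^ₚ j)
^-nonzero nzP zero    = trimmed-nonzero [1]
^-nonzero nzP (suc j) = *ₚ-nonzero nzP (^-nonzero nzP j)

len-^ : ∀ {P t} → len P ≡ suc t → ∀ j → len (P ^ₚ j) ≡ suc (j * t)
len-^ lP zero    = refl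
len-^ {P} {t} lP (suc j) = suc-injective (begin
  suc (len (P *ₚ P ^ₚ j))     ≡⟨ len-* nzP (^-nonzero nzP j) ⟩
  len P + len (P ^ₚ j)        ≡⟨ cong₂ _+_ lP (len-^ lP j) ⟩
  suc t + suc (j * t)         ≡⟨ cong suc (+-suc t (j * t)) ⟩
  suc (suc (t + j * t))       ∎)
  where
  open ≡-Reasoning
  nzP : ¬ Zero P
  nzP = len-pos⇒nonzero (subst (1 ≤_) (sym lP) (s≤s z≤n))

-- The field with four elements, 𝔽₄ = 𝔽₂(ω) with ω² = ω + 1.
data 𝔽₄ : Set where
  0# 1# ω ω² : 𝔽₄

infixl 6 _⊕_
infixl 7 _⊗_

_⊕_ : 𝔽₄ → 𝔽₄ → 𝔽₄
0# ⊕ y  = y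
1# ⊕ 0# = 1#
1# ⊕ 1# = 0#
1# ⊕ ω  = ω²
1# ⊕ ω² = ω
ω  ⊕ 0# = ω
ω  ⊕ 1# = ω²
ω  ⊕ ω  = 0#
ω  ⊕ ω² = 1#
ω² ⊕ 0# = ω²
ω² ⊕ 1# = ω
ω² ⊕ ω  = 1#
ω² ⊕ ω² = 0#

_⊗_ : 𝔽₄ → 𝔽₄ → 𝔽₄
0# ⊗ y  = 0#
1# ⊗ y  = y
ω  ⊗ 0# = 0#
ω  ⊗ 1# = ω
ω  ⊗ ω  = ω²
ω  ⊗ ω² = 1#
ω² ⊗ 0# = 0#
ω² ⊗ 1# = ω²
ω² ⊗ ω  = 1#
ω² ⊗ ω² = ω

-- Identities in 𝔽₄ are verified by evaluating both sides at all points;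
-- ∧-left and ∧-right extract the conjuncts of such a Boolean check.

_==_ : 𝔽₄ → 𝔽₄ → Bool
0# == 0# = true
1# == 1# = true
ω  == ω  = true
ω² == ω² = true
_  == _  = false

==-sound : ∀ x y → T (x == y) → x ≡ y
==-sound 0# 0# _ = refl
==-sound 1# 1# _ = refl
==-sound ω  ω  _ = refl
==-sound ω² ω² _ = refl

∧-left : ∀ a {b} → T (a ∧ b) → T a
∧-left true _ = tt

∧-right : ∀ a {b} → T (a ∧ b) → T b
∧-right true h = h

every : (𝔽₄ → Bool) → Bool
every p = p 0# ∧ p 1# ∧ p ω ∧ p ω²

every-sound : ∀ p → T (every p) → ∀ x → T (p x)
every-sound p h 0# = ∧-left (p 0#) h
every-sound p h 1# = ∧-left (p 1#) (∧-right (p 0#) h)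
every-sound p h ω  = ∧-left (p ω) (∧-right (p 1#) (∧-right (p 0#) h))
every-sound p h ω² = ∧-right (p ω) (∧-right (p 1#) (∧-right (p 0#) h))

identity₃ : (l r : 𝔽₄ → 𝔽₄ → 𝔽₄ → 𝔽₄) →
            T (every λ x → every λ y → every λ z → l x y z == r x y z) →
            ∀ x y z → l x y z ≡ r x y z
identity₃ l r h x y z =
  ==-sound _ _ (every-sound (λ z → l x y z == r x y z)
    (every-sound (λ y → every λ z → l x y z == r x y z)
      (every-sound (λ x → every λ y → every λ z → l x y z == r x y z) h x) y) z)

identity₄ : (l r : 𝔽₄ → 𝔽₄ → 𝔽₄ → 𝔽₄ → 𝔽₄) →
            T (every λ u → every λ x → every λ y → every λ z → l u x y z == r u x y z) →
            ∀ u x y z → l u x y z ≡ r u x y z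
identity₄ l r h u =
  identity₃ (l u) (r u) (every-sound (λ u → every λ x → every λ y → every λ z → l u x y z == r u x y z) h u)

⟦_⟧ : Bool → 𝔽₄
⟦ false ⟧ = 0#
⟦ true  ⟧ = 1#

eval : Poly → 𝔽₄
eval []      = 0#
eval (b ∷ p) = ⟦ b ⟧ ⊕ ω ⊗ eval p

⟦⟧-xor : ∀ a b → ⟦ a xor b ⟧ ≡ ⟦ a ⟧ ⊕ ⟦ b ⟧
⟦⟧-xor true  true  = refl
⟦⟧-xor true  false = refl
⟦⟧-xor false b     = refl

⟦⟧-∧ : ∀ a b → ⟦ a ∧ b ⟧ ≡ ⟦ a ⟧ ⊗ ⟦ b ⟧
⟦⟧-∧ true  b = refl
⟦⟧-∧ false b = refl

horner-+ : ∀ u v x y → (u ⊕ v) ⊕ ω ⊗ (x ⊕ y) ≡ (u ⊕ ω ⊗ x) ⊕ (v ⊕ ω ⊗ y)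
horner-+ = identity₄ (λ u v x y → (u ⊕ v) ⊕ ω ⊗ (x ⊕ y)) (λ u v x y → (u ⊕ ω ⊗ x) ⊕ (v ⊕ ω ⊗ y)) tt

horner-scale : ∀ u v x → u ⊗ v ⊕ ω ⊗ (u ⊗ x) ≡ u ⊗ (v ⊕ ω ⊗ x)
horner-scale = identity₃ (λ u v x → u ⊗ v ⊕ ω ⊗ (u ⊗ x)) (λ u v x → u ⊗ (v ⊕ ω ⊗ x)) tt

horner-* : ∀ u x y → u ⊗ y ⊕ ω ⊗ (x ⊗ y) ≡ (u ⊕ ω ⊗ x) ⊗ y
horner-* = identity₃ (λ u x y → u ⊗ y ⊕ ω ⊗ (x ⊗ y)) (λ u x y → (u ⊕ ω ⊗ x) ⊗ y) tt

⊕-identityʳ : ∀ x → x ⊕ 0# ≡ x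
⊕-identityʳ 0# = refl
⊕-identityʳ 1# = refl
⊕-identityʳ ω  = refl
⊕-identityʳ ω² = refl

⊗-zeroʳ : ∀ x → x ⊗ 0# ≡ 0#
⊗-zeroʳ 0# = refl
⊗-zeroʳ 1# = refl
⊗-zeroʳ ω  = refl
⊗-zeroʳ ω² = refl

eval-+ : ∀ p q → eval (p +ₚ q) ≡ eval p ⊕ eval q
eval-+ []      q       = refl
eval-+ (a ∷ p) []      = sym (⊕-identityʳ _)
eval-+ (a ∷ p) (b ∷ q) =
  trans (cong₂ (λ c e → c ⊕ ω ⊗ e) (⟦⟧-xor a b) (eval-+ p q)) (horner-+ ⟦ a ⟧ ⟦ b ⟧ (eval p) (eval q))

eval-scale : ∀ a q → eval (scale a q) ≡ ⟦ a ⟧ ⊗ eval q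
eval-scale a []      = sym (⊗-zeroʳ ⟦ a ⟧)
eval-scale a (b ∷ q) =
  trans (cong₂ (λ c e → c ⊕ ω ⊗ e) (⟦⟧-∧ a b) (eval-scale a q)) (horner-scale ⟦ a ⟧ ⟦ b ⟧ (eval q))

eval-* : ∀ p q → eval (p *ₚ q) ≡ eval p ⊗ eval q
eval-* []      q = refl
eval-* (a ∷ p) q =
  trans (eval-+ (scale a q) (false ∷ (p *ₚ q)))
    (trans (cong₂ (λ s e → s ⊕ ω ⊗ e) (eval-scale a q) (eval-* p q)) (horner-* ⟦ a ⟧ (eval p) (eval q)))

eval-zero : ∀ {p} → Zero p → eval p ≡ 0#
eval-zero {[]}    z = refl
eval-zero {b ∷ p} z rewrite zero-head z | eval-zero (zero-tail z) = refl

⊕≡0⇒≡ : ∀ x y → x ⊕ y ≡ 0# → x ≡ y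
⊕≡0⇒≡ 0# 0# _ = refl
⊕≡0⇒≡ 1# 1# _ = refl
⊕≡0⇒≡ ω  ω  _ = refl
⊕≡0⇒≡ ω² ω² _ = refl

eval-cong : ∀ {p q} → p ~ q → eval p ≡ eval q
eval-cong {p} {q} e = ⊕≡0⇒≡ (eval p) (eval q)
  (trans (sym (eval-+ p q)) (eval-zero (~-trans (+ₚ-cong e ~-refl) (+ₚ-self q))))

-- ω is a root of M₁ = 1 + x + x², so M₁ divides only polynomials vanishing at ω
M₁-divides⇒root : ∀ {A} → M₁ ∣ₚ A → eval A ≡ 0#
M₁-divides⇒root {A} (c , M₁c≈A) = trans (sym (eval-cong (≈ₚ⇒~ {M₁ *ₚ c} {A} M₁c≈A))) (eval-* M₁ c)

-- n · 1 in 𝔽₄, which only depends on the parity of n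
parity : ℕ → 𝔽₄
parity zero    = 0#
parity (suc n) = 1# ⊕ parity n

parity-double : ∀ n → parity (n + n) ≡ 0#
parity-double zero = refl
parity-double (suc n) rewrite +-suc n n | parity-double n = refl

eval-sum-of-ones : ∀ {L} → All (λ d → eval d ≡ 1#) L → eval (sum L) ≡ parity (length L)
eval-sum-of-ones []           = refl
eval-sum-of-ones {d ∷ L} (e ∷ es) = trans (eval-+ d (sum L)) (cong₂ _⊕_ e (eval-sum-of-ones es))

∑-list : ∀ {A : Set} → List A → (A → ℕ) → ℕ
∑-list []       f = 0
∑-list (x ∷ xs) f = f x + ∑-list xs f

syntax ∑-list L (λ x → e) = ∑[ x ∈ L ] e

∑-below : ℕ → (ℕ → ℕ) → ℕ
∑-below zero    f = 0
∑-below (suc m) f = f m + ∑-below m f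

syntax ∑-below m (λ j → e) = ∑[ j < m ] e

𝟙 : Bool → ℕ
𝟙 true  = 1
𝟙 false = 0

module _ {A : Set} where

  ∑-++ : ∀ (xs ys : List A) f → ∑-list (xs ++ ys) f ≡ ∑-list xs f + ∑-list ys f
  ∑-++ []       ys f = refl
  ∑-++ (x ∷ xs) ys f = trans (cong (f x +_) (∑-++ xs ys f)) (sym (+-assoc (f x) _ _))

  ∑-map : ∀ {B : Set} (h : B → A) xs f → ∑-list (map h xs) f ≡ ∑[ x ∈ xs ] f (h x)
  ∑-map h []       f = refl
  ∑-map h (x ∷ xs) f = cong (f (h x) +_) (∑-map h xs f)

  ∑-cong : ∀ (xs : List A) {f g} → (∀ x → f x ≡ g x) → ∑-list xs f ≡ ∑-list xs g
  ∑-cong []       e = refl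
  ∑-cong (x ∷ xs) e = cong₂ _+_ (e x) (∑-cong xs e)

  ∑-+ : ∀ (xs : List A) f g → ∑[ x ∈ xs ] (f x + g x) ≡ ∑-list xs f + ∑-list xs g
  ∑-+ []       f g = refl
  ∑-+ (x ∷ xs) f g = trans (cong (f x + g x +_) (∑-+ xs f g)) (interchange +-commutativeSemigroup (f x) (g x) _ _)

  ∑-mono : ∀ (xs : List A) {f g} → (∀ x → f x ≤ g x) → ∑-list xs f ≤ ∑-list xs g
  ∑-mono []       le = z≤n
  ∑-mono (x ∷ xs) le = +-mono-≤ (le x) (∑-mono xs le)

  ∑-swap : ∀ (xs : List A) m (f : A → ℕ → ℕ) → ∑[ x ∈ xs ] ∑[ j < m ] f x j ≡ ∑[ j < m ] ∑[ x ∈ xs ] f x j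
  ∑-swap xs zero    f = ∑-zero xs
    where
    ∑-zero : ∀ (xs : List A) → ∑[ x ∈ xs ] 0 ≡ 0
    ∑-zero []       = refl
    ∑-zero (x ∷ xs) = ∑-zero xs
  ∑-swap xs (suc m) f = trans (∑-+ xs (λ x → f x m) (λ x → ∑-below m (f x))) (cong (∑-list xs (λ x → f x m) +_) (∑-swap xs m f))

∑-below-cong : ∀ m {f g} → (∀ j → j < m → f j ≡ g j) → ∑-below m f ≡ ∑-below m g
∑-below-cong zero    e = refl
∑-below-cong (suc m) e = cong₂ _+_ (e m ≤-refl) (∑-below-cong m (λ j j<m → e j (m≤n⇒m≤1+n j<m)))

∑-below-ones : ∀ m → ∑[ j < m ] 1 ≡ m
∑-below-ones zero    = refl
∑-below-ones (suc m) = cong suc (∑-below-ones m)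

∑-none : ∀ m (f : ℕ → Bool) → (∀ j → j < m → f j ≡ false) → ∑[ j < m ] 𝟙 (f j) ≡ 0
∑-none zero    f none = refl
∑-none (suc m) f none rewrite none m ≤-refl = ∑-none m f (λ j j<m → none j (m≤n⇒m≤1+n j<m))

∑-unique : ∀ m (f : ℕ → Bool) j₀ → j₀ < m → f j₀ ≡ true → (∀ j → j < m → f j ≡ true → j ≡ j₀) →
           ∑[ j < m ] 𝟙 (f j) ≡ 1
∑-unique (suc m) f j₀ j₀<1+m fj₀ unique with f m in fm
... | true  = cong suc (∑-none m f (λ j j<m → ¬-not (λ fj → <-irrefl (j≡m j j<m fj) j<m)))
  where
  j≡m : ∀ j → j < m → f j ≡ true → j ≡ m
  j≡m j j<m fj = trans (unique j (m≤n⇒m≤1+n j<m) fj) (sym (unique m ≤-refl fm))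
... | false = ∑-unique m f j₀ (≤∧≢⇒< (≤-pred j₀<1+m) j₀≢m) fj₀ (λ j j<m → unique j (m≤n⇒m≤1+n j<m))
  where
  j₀≢m : j₀ ≢ m
  j₀≢m refl = case trans (sym fj₀) fm of λ ()

same : Bool → Bool → Bool
same a b = not (a xor b)

infix 4 _=ₚ_
_=ₚ_ : Poly → Poly → Bool
[]      =ₚ q = isZero q
(a ∷ p) =ₚ q = same a (coef q 0) ∧ (p =ₚ drop 1 q)

split : ∀ q → q ~ coef q 0 ∷ drop 1 q
split []      = coeffwise λ { zero → refl ; (suc i) → refl }
split (b ∷ q) = ~-refl

=ₚ-sound : ∀ p q → (p =ₚ q) ≡ true → p ~ q
=ₚ-sound []      q h = ~-sym (isZero-sound q h)
=ₚ-sound (a ∷ p) q h with same a (coef q 0) in s | p =ₚ drop 1 q in t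
=ₚ-sound (a ∷ p) q refl | true | true =
  ~-trans (∷-cong (same-sound a (coef q 0) s) (=ₚ-sound p (drop 1 q) t)) (~-sym (split q))
  where
  same-sound : ∀ a b → same a b ≡ true → a ≡ b
  same-sound true  true  _ = refl
  same-sound false false _ = refl

=ₚ-complete : ∀ p q → p ~ q → (p =ₚ q) ≡ true
=ₚ-complete []      q e = isZero-complete q (~-sym e)
=ₚ-complete (a ∷ p) q e with ~-trans e (split q)
... | e' rewrite ∷-head e' | =ₚ-complete p (drop 1 q) (∷-tail e') = same-refl (coef q 0)
  where
  same-refl : ∀ b → same b b ∧ true ≡ true
  same-refl true  = refl
  same-refl false = refl

len-drop : ∀ t N → len t ≤ suc N → len (drop 1 t) ≤ N
len-drop []      N le = z≤n
len-drop (c ∷ t) N le with norm t | le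
... | []    | _   = z≤n
... | _ ∷ _ | le' = ≤-pred le'

enumerate-once : ∀ N t → len t ≤ N → ∑[ l ∈ allLists N ] 𝟙 (l =ₚ t) ≡ 1
enumerate-once zero    t le rewrite isZero-complete t (len≡0⇒zero (n≤0⇒n≡0 le)) = refl
enumerate-once (suc N) t le = begin
  ∑[ l ∈ map (false ∷_) L ++ map (true ∷_) L ] 𝟙 (l =ₚ t)
    ≡⟨ ∑-++ (map (false ∷_) L) _ _ ⟩
  ∑-list (map (false ∷_) L) (λ l → 𝟙 (l =ₚ t)) + ∑-list (map (true ∷_) L) (λ l → 𝟙 (l =ₚ t))
    ≡⟨ cong₂ _+_ (∑-map (false ∷_) L _) (∑-map (true ∷_) L _) ⟩
  ∑[ l ∈ L ] 𝟙 (same false c ∧ E l) + ∑[ l ∈ L ] 𝟙 (same true c ∧ E l)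
    ≡⟨ sym (∑-+ L _ _) ⟩
  ∑[ l ∈ L ] (𝟙 (same false c ∧ E l) + 𝟙 (same true c ∧ E l))
    ≡⟨ ∑-cong L (λ l → exactly-one-head c (E l)) ⟩
  ∑[ l ∈ L ] 𝟙 (E l)
    ≡⟨ enumerate-once N (drop 1 t) (len-drop t N le) ⟩
  1 ∎
  where
  open ≡-Reasoning
  L = allLists N
  c = coef t 0
  E = λ l → l =ₚ drop 1 t
  exactly-one-head : ∀ c e → 𝟙 (same false c ∧ e) + 𝟙 (same true c ∧ e) ≡ 𝟙 e
  exactly-one-head true  e = refl
  exactly-one-head false e = +-identityʳ (𝟙 e)

properFactor? : Poly → Poly → Bool
properFactor? F l = (2 ≤ᵇ len l) ∧ (len l <ᵇ len F) ∧ divides? l F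

smallFactors : ℕ → Poly → ℕ
smallFactors k F = ∑[ l ∈ allLists k ] 𝟙 (properFactor? F l)

properFactor?-complete : ∀ F a → 2 ≤ len a → len a < len F → a ∣ F → properFactor? F a ≡ true
properFactor?-complete F a 2≤a a<F a∣F
  rewrite Equivalence.to T-≡ (≤⇒≤ᵇ 2≤a) | Equivalence.to T-≡ (<⇒<ᵇ a<F) =
  divides?-complete (len-pos⇒nonzero (<⇒≤ 2≤a)) a∣F

cofactor-bounds : ∀ {x y s} → x + y ≡ suc s → 2 ≤ x → x < s → 2 ≤ y × y < s
cofactor-bounds {x} {y} {s} eq 2≤x x<s = +-cancelˡ-≤ x 2 y x+2≤x+y , ≤-pred 2+y≤1+s
  where
  open ≤-Reasoning
  x+2≤x+y : x + 2 ≤ x + y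
  x+2≤x+y = begin
    x + 2         ≡⟨ +-comm x 2 ⟩
    suc (suc x)   ≤⟨ s≤s x<s ⟩
    suc s         ≡⟨ eq ⟨
    x + y         ∎
  2+y≤1+s : 2 + y ≤ suc s
  2+y≤1+s = begin
    2 + y ≤⟨ +-monoˡ-≤ y 2≤x ⟩
    x + y ≡⟨ eq ⟩
    suc s ∎

one-small : ∀ {x y s} k → x + y ≡ suc s → s ≤ k + k → ¬ x ≤ k → y ≤ k
one-small {x} {y} {s} k eq s≤2k x≰k with y ≤? k
... | yes y≤k = y≤k
... | no  y≰k = ⊥-elim (<-irrefl refl (begin-strict
  suc (k + k)     ≡⟨ +-suc k k ⟨
  k + suc k       <⟨ +-mono-≤ (≰⇒> x≰k) (≰⇒> y≰k) ⟩
  x + y           ≡⟨ eq ⟩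
  suc s           ≤⟨ s≤s s≤2k ⟩
  suc (k + k)     ∎))
  where open ≤-Reasoning

-- A polynomial with no proper factor of length at most k, and of length at
-- most 2k, is irreducible: in a factorisation F = a c one factor is that short.
irreducible-by-search : ∀ k F → 2 ≤ len F → len F ≤ k + k → smallFactors k F ≡ 0 → Irreducible F
irreducible-by-search k F 2≤F F≤2k none = record
  { nonconstant = 2≤F
  ; no-proper-factor = no-proper-factor }
  where
  nzF : ¬ Zero F
  nzF = len-pos⇒nonzero (<⇒≤ 2≤F)

  not-counted : ∀ e → 2 ≤ len e → len e < len F → len e ≤ k → ¬ (e ∣ F)
  not-counted e 2≤e e<F e≤k e∣F = <-irrefl refl (subst (1 ≤_) none (subst (_≤ smallFactors k F) (enumerate-once k e e≤k)
    (∑-mono (allLists k) (λ l → 𝟙-mono (equal⇒factor l)))))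
    where
    𝟙-mono : ∀ {a b} → (a ≡ true → b ≡ true) → 𝟙 a ≤ 𝟙 b
    𝟙-mono {false} f = z≤n
    𝟙-mono {true}  f rewrite f refl = s≤s z≤n
    equal⇒factor : ∀ l → (l =ₚ e) ≡ true → properFactor? F l ≡ true
    equal⇒factor l h = properFactor?-complete F l (subst (2 ≤_) (sym (len-cong l~e)) 2≤e)
      (subst (_< len F) (sym (len-cong l~e)) e<F) (∣-respˡ (~-sym l~e) e∣F)
      where l~e = =ₚ-sound l e h

  no-proper-factor : ∀ a → 2 ≤ len a → len a < len F → ¬ (a ∣ F)
  no-proper-factor a 2≤a a<F (divides c ac~F) with len a ≤? k
  ... | yes a≤k = not-counted a 2≤a a<F a≤k (divides c ac~F)
  ... | no  a≰k = not-counted c 2≤c c<F (one-small k eq F≤2k a≰k) (divides a (~-trans (*ₚ-comm c a) ac~F))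
    where
    nza : ¬ Zero a
    nza = len-pos⇒nonzero (<⇒≤ 2≤a)
    nzc : ¬ Zero c
    nzc z = nzF (~-trans (~-sym ac~F) (*ₚ-zeroʳ a z))
    eq : len a + len c ≡ suc (len F)
    eq = trans (sym (len-* nza nzc)) (cong suc (len-cong ac~F))
    bounds = cofactor-bounds eq 2≤a a<F
    2≤c = proj₁ bounds
    c<F = proj₂ bounds

isDivisor : Poly → Poly → Bool
isDivisor A d = not (isZero d) ∧ divides? d A

isDivisor-sound : ∀ A d → isDivisor A d ≡ true → ¬ Zero d × d ∣ A
isDivisor-sound A d h = nz , divides?-sound nz (subst (λ b → not b ∧ divides? d A ≡ true) (isZero-nonzero d nz) h)
  where
  nz : ¬ Zero d
  nz zd = case trans (sym h) (cong (λ b → not b ∧ divides? d A) (isZero-complete d zd)) of λ ()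

isDivisor-complete : ∀ A d → ¬ Zero d → d ∣ A → isDivisor A d ≡ true
isDivisor-complete A d nz d∣A =
  subst (λ b → not b ∧ divides? d A ≡ true) (sym (isZero-nonzero d nz)) (divides?-complete nz d∣A)

length-filter-map : ∀ (P : Poly → Bool) L →
  length (filter (λ d → P d Bool.≟ true) (map norm L)) ≡ ∑[ l ∈ L ] 𝟙 (P (norm l))
length-filter-map P []      = refl
length-filter-map P (l ∷ L) with P (norm l)
... | true  = cong suc (length-filter-map P L)
... | false = length-filter-map P L

all-divisors : ∀ A → All (λ d → ¬ Zero d × d ∣ A) (divisors A)
all-divisors A = All.map (isDivisor-sound A _) (all-filter (λ d → isDivisor A d Bool.≟ true) (map norm (allLists (len A))))

module PrimePower {P : Poly} (irr : Irreducible P) where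
  open Irreducible irr

  -- P has degree t + 1 ≥ 1
  t : ℕ
  t = len P ∸ 2

  len-P : len P ≡ suc (suc t)
  len-P = sym (m+[n∸m]≡n nonconstant)

  ^-injective : ∀ {j k} → P ^ₚ j ~ P ^ₚ k → j ≡ k
  ^-injective {j} {k} e = *-cancelʳ-≡ j k (suc t)
    (suc-injective (trans (sym (len-^ len-P j)) (trans (len-cong e) (len-^ len-P k))))

  len-^-mono : ∀ {j n} → j ≤ n → len (P ^ₚ j) ≤ len (P ^ₚ n)
  len-^-mono {j} {n} j≤n =
    subst₂ _≤_ (sym (len-^ len-P j)) (sym (len-^ len-P n)) (s≤s (*-monoˡ-≤ (suc t) j≤n))

  module _ (n : ℕ) where
    A = P ^ₚ n

    divisor-indicator : ∀ l → 𝟙 (isDivisor A (norm l)) ≡ ∑[ j < suc n ] 𝟙 (l =ₚ P ^ₚ j)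
    divisor-indicator l with isDivisor A (norm l) in h
    ... | true with isDivisor-sound A (norm l) h
    ...   | nz , d∣A with divisor-of-power irr n l (λ z → nz (~-trans (norm-~ l) z)) (∣-respˡ (norm-~ l) d∣A)
    ...     | j₀ , j₀≤n , l~Pʲ⁰ = sym (∑-unique (suc n) _ j₀ (s≤s j₀≤n) (=ₚ-complete l _ l~Pʲ⁰)
                (λ j _ eq → ^-injective (~-trans (~-sym (=ₚ-sound l _ eq)) l~Pʲ⁰)))
    divisor-indicator l | false =
      sym (∑-none (suc n) _ λ j j<1+n → ¬-not λ eq → not-divisor j j<1+n (=ₚ-sound l _ eq))
      where
      -- each power Pʲ with j ≤ n divides A, so l is none of them
      not-divisor : ∀ j → j < suc n → ¬ (l ~ P ^ₚ j)
      not-divisor j j<1+n l~Pʲ = case trans (sym h) (isDivisor-complete A (norm l) nz (∣-respˡ Pʲ~l Pʲ∣A)) of λ ()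
        where
        Pʲ~l : P ^ₚ j ~ norm l
        Pʲ~l = ~-sym (~-trans (norm-~ l) l~Pʲ)
        Pʲ∣A : P ^ₚ j ∣ A
        Pʲ∣A = power-divides P (≤-pred j<1+n)
        nz : ¬ Zero (norm l)
        nz z = ^-nonzero (irreducible-nonzero irr) j (~-trans Pʲ~l z)

    -- Pⁿ has exactly n + 1 divisors: count the candidates by double counting
    number-of-divisors : length (divisors A) ≡ suc n
    number-of-divisors = begin
      length (divisors A)                                   ≡⟨ length-filter-map (isDivisor A) L ⟩
      ∑[ l ∈ L ] 𝟙 (isDivisor A (norm l))                   ≡⟨ ∑-cong L divisor-indicator ⟩
      ∑[ l ∈ L ] ∑[ j < suc n ] 𝟙 (l =ₚ P ^ₚ j)             ≡⟨ ∑-swap L (suc n) _ ⟩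
      ∑[ j < suc n ] ∑[ l ∈ L ] 𝟙 (l =ₚ P ^ₚ j)             ≡⟨ ∑-below-cong (suc n) (λ j j<1+n →
                                                                 enumerate-once (len A) (P ^ₚ j) (len-^-mono (≤-pred j<1+n))) ⟩
      ∑[ j < suc n ] 1                                      ≡⟨ ∑-below-ones (suc n) ⟩
      suc n                                                 ∎
      where
      open ≡-Reasoning
      L = allLists (len A)

    eval-σ : eval P ≡ 1# → eval (σ A) ≡ parity (suc n)
    eval-σ P[ω]≡1 = trans (eval-sum-of-ones (All.map value-one (all-divisors A))) (cong parity number-of-divisors)
      where
      eval-^ : ∀ j → eval (P ^ₚ j) ≡ 1#
      eval-^ zero    = refl
      eval-^ (suc j) rewrite eval-* P (P ^ₚ j) | P[ω]≡1 | eval-^ j = refl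
      value-one : ∀ {d} → ¬ Zero d × d ∣ A → eval d ≡ 1#
      value-one {d} (nz , d∣A) with divisor-of-power irr n d nz d∣A
      ... | j , _ , d~Pʲ = trans (eval-cong d~Pʲ) (eval-^ j)

M₁∤σ-even-power : ∀ {P} → Irreducible P → eval P ≡ 1# → ∀ n → parity n ≡ 0# → M₁ ∤ₚ σ (P ^ₚ n)
M₁∤σ-even-power {P} irr P[ω]≡1 n even M₁∣σ = case σ[ω]≡1 of λ ()
  where
  open ≡-Reasoning
  σ[ω]≡1 : 0# ≡ 1#
  σ[ω]≡1 = begin
    0#                  ≡⟨ M₁-divides⇒root {σ (P ^ₚ n)} M₁∣σ ⟨
    eval (σ (P ^ₚ n))   ≡⟨ PrimePower.eval-σ irr n P[ω]≡1 ⟩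
    1# ⊕ parity n       ≡⟨ cong (1# ⊕_) even ⟩
    1#                  ∎

certificate : Poly → Bool
certificate P = (2 ≤ᵇ len P) ∧ (len P ≤ᵇ 14) ∧ (smallFactors 7 P ≡ᵇ 0) ∧ (eval P == 1#)

certificate-sound : ∀ P → T (certificate P) → Irreducible P × eval P ≡ 1#
certificate-sound P c =
  irreducible-by-search 7 P (≤ᵇ⇒≤ 2 (len P) c₁) (≤ᵇ⇒≤ (len P) 14 c₂) (≡ᵇ⇒≡ (smallFactors 7 P) 0 c₃) ,
  ==-sound (eval P) 1# c₄
  where
  c₁ = ∧-left (2 ≤ᵇ len P) c
  c₂ = ∧-left (len P ≤ᵇ 14) (∧-right (2 ≤ᵇ len P) c)
  c₃ = ∧-left (smallFactors 7 P ≡ᵇ 0) (∧-right (len P ≤ᵇ 14) (∧-right (2 ≤ᵇ len P) c))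
  c₄ = ∧-right (smallFactors 7 P ≡ᵇ 0) (∧-right (len P ≤ᵇ 14) (∧-right (2 ≤ᵇ len P) c))

S-certified : ∀ i → T (certificate (S i))
S-certified i1  = tt
S-certified i2  = tt
S-certified i3  = tt
S-certified i4  = tt
S-certified i5  = tt
S-certified i6  = tt
S-certified i7  = tt
S-certified i8  = tt
S-certified i9  = tt
S-certified i10 = tt
S-certified i11 = tt
S-certified i12 = tt
S-certified i13 = tt
S-certified i14 = tt
S-certified i15 = tt

lemma3p23 : (i : Idx) (h : ℕ) → M₁ ∤ₚ σ (S i ^ₚ (2 * suc h))
lemma3p23 i h with certificate-sound (S i) (S-certified i)
... | irr , S[ω]≡1 = M₁∤σ-even-power irr S[ω]≡1 (2 * suc h) even
  where
  even : parity (2 * suc h) ≡ 0#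
  even rewrite +-identityʳ (suc h) = parity-double (suc h)
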